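{- Let $\Gamma,\Delta$ be finite sets of formulas in $For_1$ with $\Gamma\cup\Delta$ nonempty. If $\Gamma\Rightarrow\Delta$ is provable in the $\{\lnot,\vee\}$-fragment of the classical calculus $\mathbf{C}$ and $var(\Gamma)\subseteq var(\Delta)$, then $\Gamma\Rightarrow\Delta$ is provable in $\mathbf{H}$ without using the Cut rule.
   Context: Fix a denumerable set $prop$ of propositional variables. $For_1$ is the set of formulas built from $prop$ with unary $\lnot$ and binary $\vee$. $var(\alpha)$ is the set of propositional variables in $\alpha$; $var(\Gamma)=\bigcup_{\gamma\in\Gamma}var(\gamma)$. A sequent $\Gamma\Rightarrow\Delta$ is an ordered pair of finite sets of formulas, not both empty; $\alpha,\Gamma$ denotes $\Gamma\cup\{\alpha\}$. The $\{\lnot,\vee\}$-fragment of $\mathbf{C}$ has the axiom $\alpha\Rightarrow\alpha$ and the rules (premises / conclusion): (W$\Rightarrow$) $\Gamma\Rightarrow\Delta$ / $\alpha,\Gamma\Rightarrow\Delta$; ($\Rightarrow$W) $\Gamma\Rightarrow\Delta$ / $\Gamma\Rightarrow\Delta,\alpha$; (Cut) $\Gamma\Rightarrow\Delta,\alpha$ and $\alpha,\Gamma\Rightarrow\Delta$ / $\Gamma\Rightarrow\Delta$; ($\Rightarrow\lnot$) $\alpha,\Gamma\Rightarrow\Delta$ / $\Gamma\Rightarrow\Delta,\lnot\alpha$; ($\lnot\Rightarrow$) $\Gamma\Rightarrow\Delta,\alpha$ / $\lnot\alpha,\Gamma\Rightarrow\Delta$; ($\vee\Rightarrow$) $\alpha_1,\Gamma\Rightarrow\Delta$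 and $\alpha_2,\Gamma\Rightarrow\Delta$ / $\alpha_1\vee\alpha_2,\Gamma\Rightarrow\Delta$; ($\Rightarrow\vee$) $\Gamma\Rightarrow\Delta,\alpha_1,\alpha_2$ / $\Gamma\Rightarrow\Delta,\alpha_1\vee\alpha_2$. The calculus $\mathbf{H}$ is identical except that ($\lnot\Rightarrow$) is replaced by ($\lnot^H\Rightarrow$): $\Gamma\Rightarrow\Delta,\alpha$ / $\lnot\alpha,\Gamma\Rightarrow\Delta$, allowed only if $var(\alpha)\subseteq var(\Delta)$. -}

module Defs where

open import Data.Nat using (ℕ)
open import Data.Bool using (Bool; true; false)
open import Data.List using (List; []; _∷_; _++_; concatMap)
open import Data.List.Membership.Propositional using (_∈_)
open import Data.Product using (_×_)
open import Data.Sum using (_⊎_)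
open import Relation.Binary.PropositionalEquality using (_≡_)
open import Relation.Nullary using (¬_)

Prop : Set
Prop = ℕ

data For₁ : Set where
  var  : Prop → For₁
  ¬'_  : For₁ → For₁
  _∨'_ : For₁ → For₁ → For₁

-- var(α), as a list (membership is what matters).
vars : For₁ → List Prop
vars (var p)  = p ∷ []
vars (¬' a)   = vars a
vars (a ∨' b) = vars a ++ vars b

-- Finite sets of formulas are represented by lists, compared extensionally.
FSet : Set
FSet = List For₁

varsS : FSet → List Prop
varsS = concatMap vars

_⊆ᵛ_ : FSet → FSet → Set
Γ ⊆ᵛ Δ = ∀ p → p ∈ varsS Γ → p ∈ varsS Δ

_≋_ : FSet → FSet → Set
X ≋ Y = ∀ x → (x ∈ X → x ∈ Y) × (x ∈ Y → x ∈ X)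

NonEmptySeq : FSet → FSet → Set
NonEmptySeq [] [] = Data.Empty.⊥ where import Data.Empty
NonEmptySeq _ _ = Data.Unit.⊤ where import Data.Unit

-- Which calculus: C (classical ¬⇒) or H (restricted ¬ᴴ⇒).
data Calc : Set where
  C H : Calc

-- Every conclusion is stated up to set equality
-- (α,Γ denotes Γ ∪ {α}), so the predicate respects the set reading of sequents.
data ⊢[_,_]_⇒_ (K : Calc) (cut : Bool) : FSet → FSet → Set where
  ax   : ∀ {Γ Δ} α → Γ ≋ (α ∷ []) → Δ ≋ (α ∷ []) → ⊢[ K , cut ] Γ ⇒ Δ
  W⇒   : ∀ {Γ Δ Γ'} α → ⊢[ K , cut ] Γ ⇒ Δ → Γ' ≋ (α ∷ Γ) → ⊢[ K , cut ] Γ' ⇒ Δ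
  ⇒W   : ∀ {Γ Δ Δ'} α → ⊢[ K , cut ] Γ ⇒ Δ → Δ' ≋ (α ∷ Δ) → ⊢[ K , cut ] Γ ⇒ Δ'
  Cut  : ∀ {Γ Δ Δα αΓ} α → cut ≡ true → NonEmptySeq Γ Δ →
         Δα ≋ (α ∷ Δ) → αΓ ≋ (α ∷ Γ) →
         ⊢[ K , cut ] Γ ⇒ Δα → ⊢[ K , cut ] αΓ ⇒ Δ → ⊢[ K , cut ] Γ ⇒ Δ
  ⇒¬   : ∀ {Γ Δ αΓ Δ'} α → αΓ ≋ (α ∷ Γ) → Δ' ≋ ((¬' α) ∷ Δ) →
         ⊢[ K , cut ] αΓ ⇒ Δ → ⊢[ K , cut ] Γ ⇒ Δ'
  ¬⇒   : ∀ {Γ Δ Δα Γ'} α → K ≡ C → Δα ≋ (α ∷ Δ) → Γ' ≋ ((¬' α) ∷ Γ) →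
         ⊢[ K , cut ] Γ ⇒ Δα → ⊢[ K , cut ] Γ' ⇒ Δ
  ¬ᴴ⇒  : ∀ {Γ Δ Δα Γ'} α → K ≡ H → (∀ p → p ∈ vars α → p ∈ varsS Δ) →
         Δα ≋ (α ∷ Δ) → Γ' ≋ ((¬' α) ∷ Γ) →
         ⊢[ K , cut ] Γ ⇒ Δα → ⊢[ K , cut ] Γ' ⇒ Δ
  ∨⇒   : ∀ {Γ Δ α₁Γ α₂Γ Γ'} α₁ α₂ → α₁Γ ≋ (α₁ ∷ Γ) → α₂Γ ≋ (α₂ ∷ Γ) →
         Γ' ≋ ((α₁ ∨' α₂) ∷ Γ) →
         ⊢[ K , cut ] α₁Γ ⇒ Δ → ⊢[ K , cut ] α₂Γ ⇒ Δ → ⊢[ K , cut ] Γ' ⇒ Δ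
  ⇒∨   : ∀ {Γ Δ Δαα Δ'} α₁ α₂ → Δαα ≋ (α₁ ∷ α₂ ∷ Δ) →
         Δ' ≋ ((α₁ ∨' α₂) ∷ Δ) →
         ⊢[ K , cut ] Γ ⇒ Δαα → ⊢[ K , cut ] Γ ⇒ Δ'

-- The proof is semantic.  A C-derivation (with Cut) of Γ ⇒ Δ is sound, so the
-- sequent is classically valid.  Conversely, every valid sequent Γ ⇒ Δ with
-- var(Γ) ⊆ var(Δ) has a cut-free H-derivation, found by root-first proof search
-- with the invertible rules: decompose the left side first, then the right side,
-- and close atomic sequents by a shared atom plus weakenings.
--   The only delicate rule is (¬ᴴ⇒), whose side condition demands that the
-- variables of the principal formula occur on the right.  The search therefore
-- carries the invariant var(Γ) ⊆ var(P , Δ), where P is a reserve of right-hand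
-- formulas that are never decomposed: when (⇒¬) is applied to ¬a the formula ¬a
-- itself is kept in P (a contraction, free in the set reading of sequents), so
-- that the variables of a, now moved to the left, stay covered.  The search
-- terminates because the total weight of Γ , Δ (reserve excluded) decreases.
module Submission where

open import Defs
open import Data.Bool using (Bool; true; false; not; _∨_)
open import Data.Bool.Properties using (∨-zeroʳ; T-≡)
open import Data.Nat using (ℕ; zero; suc; _+_; _≤_; _<_; z≤n; s≤s)
open import Data.Nat.Properties
  using (_≟_; ≤-refl; ≤-reflexive; ≤-trans; <-≤-trans; ≤-pred; +-identityʳ;
         +-monoʳ-≤; +-monoˡ-<; m≤n+m; module ≤-Reasoning)
open import Data.Nat.ListAction using (sum)
open import Data.Nat.ListAction.Properties using (sum-++; sum-↭)
open import Data.List using (List; []; _∷_; _++_; map)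
open import Data.List.Properties using (map-++)
open import Data.List.Membership.Propositional using (_∈_)
open import Data.List.Membership.Propositional.Properties using (∈-++⁺ˡ; ∈-++⁺ʳ; ∈-++⁻)
open import Data.List.Membership.DecPropositional _≟_ using (_∈?_)
open import Data.List.Relation.Unary.Any using (here; there)
open import Data.List.Relation.Binary.Subset.Propositional using (_⊆_)
open import Data.List.Relation.Binary.Subset.Propositional.Properties
  using (⊆-refl; xs⊆x∷xs; xs⊆xs++ys; concatMap⁺)
  renaming (++⁺ʳ to ⊆-++⁺ˡ)
open import Data.List.Relation.Binary.Permutation.Propositional
  using (_↭_; prep; swap; ↭-refl; ↭-sym; ↭-trans)
open import Data.List.Relation.Binary.Permutation.Propositional.Properties
  using (shift; ∈-resp-↭; map⁺)
  renaming (++⁺ˡ to ↭-++⁺ˡ; ++⁺ʳ to ↭-++⁺ʳ)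
open import Data.Product using (_×_; _,_; ∃; proj₁; proj₂)
open import Data.Sum using (_⊎_; inj₁; inj₂)
open import Function using (_∘_; Equivalence)
open import Relation.Nullary.Decidable using (⌊_⌋; toWitness; fromWitness)
open import Relation.Binary.PropositionalEquality using (_≡_; refl; sym; trans; cong)

≋⇒⊆ : ∀ {X Y} → X ≋ Y → X ⊆ Y
≋⇒⊆ e {x} = proj₁ (e x)

≋⇒⊇ : ∀ {X Y} → X ≋ Y → Y ⊆ X
≋⇒⊇ e {x} = proj₂ (e x)

≋-refl : ∀ {X} → X ≋ X
≋-refl x = (λ m → m) , (λ m → m)

↭⇒≋ : ∀ {X Y} → X ↭ Y → X ≋ Y
↭⇒≋ π x = ∈-resp-↭ π , ∈-resp-↭ (↭-sym π)

≋-contract : ∀ {X Y a} → X ≋ (a ∷ Y) → X ≋ (a ∷ a ∷ Y)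
≋-contract e x = (there ∘ ≋⇒⊆ e) , (≋⇒⊇ e ∘ drop-copy)
  where
  drop-copy : ∀ {a Y x} → x ∈ a ∷ a ∷ Y → x ∈ a ∷ Y
  drop-copy (here refl) = here refl
  drop-copy (there m)   = m

≋-absorb : ∀ {z} Y → z ∈ Y → Y ≋ (Y ++ z ∷ [])
≋-absorb {z} Y z∈Y x = xs⊆xs++ys Y (z ∷ []) , back
  where
  back : x ∈ Y ++ z ∷ [] → x ∈ Y
  back m with ∈-++⁻ Y m
  ... | inj₁ m′          = m′
  ... | inj₂ (here refl) = z∈Y

pull : ∀ P {Δ Δ₀ : FSet} {c : For₁} → Δ ↭ (c ∷ Δ₀) → (P ++ Δ) ↭ (c ∷ P ++ Δ₀)
pull P {Δ₀ = Δ₀} {c} π = ↭-trans (↭-++⁺ˡ P π) (shift c P Δ₀)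

pull₂ : ∀ P {a b : For₁} Δ → (P ++ a ∷ b ∷ Δ) ↭ (a ∷ b ∷ P ++ Δ)
pull₂ P {a} {b} Δ = ↭-trans (shift a P (b ∷ Δ)) (prep a (shift b P Δ))

-- Semantics and soundness

ev : (Prop → Bool) → For₁ → Bool
ev v (var p)  = v p
ev v (¬' a)   = not (ev v a)
ev v (a ∨' b) = ev v a ∨ ev v b

Sat : (Prop → Bool) → FSet → Set
Sat v X = ∀ {x} → x ∈ X → ev v x ≡ true

Hits : (Prop → Bool) → FSet → Set
Hits v X = ∃ λ y → y ∈ X × ev v y ≡ true

Valid : FSet → FSet → Set
Valid Γ Δ = ∀ v → Sat v Γ → Hits v Δ

not-true : ∀ {b} → not b ≡ true → b ≡ false
not-true {false} _ = refl

∨-true : ∀ {a b} → a ∨ b ≡ true → a ≡ true ⊎ b ≡ true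
∨-true {true}  _ = inj₁ refl
∨-true {false} t = inj₂ t

∨-trueʳ : ∀ a {b} → b ≡ true → a ∨ b ≡ true
∨-trueʳ a refl = ∨-zeroʳ a

Sat-∷ : ∀ {v a X} → ev v a ≡ true → Sat v X → Sat v (a ∷ X)
Sat-∷ t s (here refl) = t
Sat-∷ t s (there m)   = s m

Hits-⊆ : ∀ {v X Y} → X ⊆ Y → Hits v X → Hits v Y
Hits-⊆ sub (y , m , t) = y , sub m , t

Hits-drop : ∀ {v a X} → Hits v (a ∷ X) → ev v a ≡ false → Hits v X
Hits-drop (y , here refl , t) f with trans (sym t) f
... | ()
Hits-drop (y , there m , t) _ = y , m , t

Hits-∨⁺ : ∀ {v a b X} → Hits v (a ∷ b ∷ X) → Hits v ((a ∨' b) ∷ X)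
Hits-∨⁺ {a = a} {b} (_ , here refl , t)         = a ∨' b , here refl , cong (_∨ _) t
Hits-∨⁺ {v} {a} {b} (_ , there (here refl) , t) = a ∨' b , here refl , ∨-trueʳ (ev v a) t
Hits-∨⁺ (y , there (there m) , t)               = y , there m , t

Hits-∨⁻ : ∀ {v a b X} → Hits v ((a ∨' b) ∷ X) → Hits v (a ∷ b ∷ X)
Hits-∨⁻ (_ , here refl , t) with ∨-true t
... | inj₁ ta = _ , here refl , ta
... | inj₂ tb = _ , there (here refl) , tb
Hits-∨⁻ (y , there m , t) = y , there (there m) , t

sound-¬⇒ : ∀ {Γ Δ Δα Γ′} a → Δα ≋ (a ∷ Δ) → Γ′ ≋ (¬' a ∷ Γ) →
           Valid Γ Δα → Valid Γ′ Δ
sound-¬⇒ a eΔ eΓ valid v sat =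
  Hits-drop (Hits-⊆ (≋⇒⊆ eΔ) (valid v (sat ∘ ≋⇒⊇ eΓ ∘ there)))
            (not-true (sat (≋⇒⊇ eΓ (here refl))))

sound : ∀ {K c Γ Δ} → ⊢[ K , c ] Γ ⇒ Δ → Valid Γ Δ
sound (ax α eΓ eΔ) v sat = α , ≋⇒⊇ eΔ (here refl) , sat (≋⇒⊇ eΓ (here refl))
sound (W⇒ α d e) v sat = sound d v (sat ∘ ≋⇒⊇ e ∘ there)
sound (⇒W α d e) v sat = Hits-⊆ (≋⇒⊇ e ∘ there) (sound d v sat)
sound (Cut α _ _ eΔ eΓ d₁ d₂) v sat with ev v α in eq
... | true  = sound d₂ v (Sat-∷ eq sat ∘ ≋⇒⊆ eΓ)
... | false = Hits-drop (Hits-⊆ (≋⇒⊆ eΔ) (sound d₁ v sat)) eq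
sound (⇒¬ α eΓ eΔ d) v sat with ev v α in eq
... | true  = Hits-⊆ (≋⇒⊇ eΔ ∘ there) (sound d v (Sat-∷ eq sat ∘ ≋⇒⊆ eΓ))
... | false = ¬' α , ≋⇒⊇ eΔ (here refl) , cong not eq
sound (¬⇒ α _ eΔ eΓ d)     = sound-¬⇒ α eΔ eΓ (sound d)
sound (¬ᴴ⇒ α _ _ eΔ eΓ d)  = sound-¬⇒ α eΔ eΓ (sound d)
sound (∨⇒ α₁ α₂ e₁ e₂ e d₁ d₂) v sat with ∨-true (sat (≋⇒⊇ e (here refl)))
... | inj₁ t₁ = sound d₁ v (Sat-∷ t₁ (sat ∘ ≋⇒⊇ e ∘ there) ∘ ≋⇒⊆ e₁)
... | inj₂ t₂ = sound d₂ v (Sat-∷ t₂ (sat ∘ ≋⇒⊇ e ∘ there) ∘ ≋⇒⊆ e₂)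
sound (⇒∨ α₁ α₂ e₁ e₂ d) v sat =
  Hits-⊆ (≋⇒⊇ e₂) (Hits-∨⁺ (Hits-⊆ (≋⇒⊆ e₁) (sound d v sat)))

Valid-⊆ : ∀ {Γ Γ′ Δ Δ′} → Γ ⊆ Γ′ → Δ ⊆ Δ′ → Valid Γ Δ → Valid Γ′ Δ′
Valid-⊆ sΓ sΔ valid v sat = Hits-⊆ sΔ (valid v (sat ∘ sΓ))

Valid-¬ˡ : ∀ {a Γ Δ} → Valid (¬' a ∷ Γ) Δ → Valid Γ (a ∷ Δ)
Valid-¬ˡ {a} valid v sat with ev v a in eq
... | true  = a , here refl , eq
... | false = Hits-⊆ there (valid v (Sat-∷ (cong not eq) sat))

Valid-∨ˡ₁ : ∀ {a b Γ Δ} → Valid ((a ∨' b) ∷ Γ) Δ → Valid (a ∷ Γ) Δ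
Valid-∨ˡ₁ valid v sat = valid v (Sat-∷ (cong (_∨ _) (sat (here refl))) (sat ∘ there))

Valid-∨ˡ₂ : ∀ {a b Γ Δ} → Valid ((a ∨' b) ∷ Γ) Δ → Valid (b ∷ Γ) Δ
Valid-∨ˡ₂ {a} valid v sat = valid v (Sat-∷ (∨-trueʳ (ev v a) (sat (here refl))) (sat ∘ there))

Valid-¬ʳ : ∀ {a Γ Δ} → Valid Γ (¬' a ∷ Δ) → Valid (a ∷ Γ) Δ
Valid-¬ʳ valid v sat = Hits-drop (valid v (sat ∘ there)) (cong not (sat (here refl)))

Valid-∨ʳ : ∀ {a b Γ Δ} → Valid Γ ((a ∨' b) ∷ Δ) → Valid Γ (a ∷ b ∷ Δ)
Valid-∨ʳ valid v sat = Hits-∨⁻ (valid v sat)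

⊆⇒⊆ᵛ : ∀ {X Y} → X ⊆ Y → X ⊆ᵛ Y
⊆⇒⊆ᵛ sub p = concatMap⁺ vars sub

vars-∈ : ∀ {x X} → x ∈ X → ∀ p → p ∈ vars x → p ∈ varsS X
vars-∈ {X = y ∷ X} (here refl) p = ∈-++⁺ˡ
vars-∈ {X = y ∷ X} (there m)   p = ∈-++⁺ʳ (vars y) ∘ vars-∈ m p

vars-∨-∈ : ∀ {a b X} → a ∈ X → b ∈ X → ∀ p → p ∈ vars (a ∨' b) → p ∈ varsS X
vars-∨-∈ {a} a∈X b∈X p m with ∈-++⁻ (vars a) m
... | inj₁ q = vars-∈ a∈X p q
... | inj₂ q = vars-∈ b∈X p q

⊆ᵛ-∷ : ∀ a X Y → (∀ p → p ∈ vars a → p ∈ varsS Y) → X ⊆ᵛ Y → (a ∷ X) ⊆ᵛ Y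
⊆ᵛ-∷ a X Y ha hX p m with ∈-++⁻ (vars a) m
... | inj₁ q = ha p q
... | inj₂ q = hX p q

w : For₁ → ℕ
w (var p)  = 0
w (¬' a)   = suc (w a)
w (a ∨' b) = suc (w a + w b)

W : FSet → ℕ
W X = sum (map w X)

W-↭ : ∀ {X Y} → X ↭ Y → W X ≡ W Y
W-↭ π = sum-↭ (map⁺ w π)

W-++ : ∀ X Y → W (X ++ Y) ≡ W X + W Y
W-++ X Y = trans (cong sum (map-++ w X Y)) (sum-++ (map w X) (map w Y))

W-decrease : ∀ {X X′ L c} Y → X ↭ (Y ++ L) → X′ ↭ (c ∷ L) → W Y < w c → W X < W X′
W-decrease {X} {X′} {L} {c} Y π π′ lighter = begin-strict
  W X        ≡⟨ trans (W-↭ π) (W-++ Y L) ⟩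
  W Y + W L  <⟨ +-monoˡ-< (W L) lighter ⟩
  w c + W L  ≡⟨ sym (W-↭ π′) ⟩
  W X′       ∎
  where open ≤-Reasoning

lighter-¬ : ∀ a → W (a ∷ []) < w (¬' a)
lighter-¬ a = s≤s (≤-reflexive (+-identityʳ (w a)))

lighter-∨₁ : ∀ a b → W (a ∷ []) < w (a ∨' b)
lighter-∨₁ a b = s≤s (+-monoʳ-≤ (w a) z≤n)

lighter-∨₂ : ∀ a b → W (b ∷ []) < w (a ∨' b)
lighter-∨₂ a b = s≤s (≤-trans (≤-reflexive (+-identityʳ (w b))) (m≤n+m (w b) (w a)))

lighter-∨ : ∀ a b → W (a ∷ b ∷ []) < w (a ∨' b)
lighter-∨ a b = s≤s (≤-reflexive (cong (w a +_) (+-identityʳ (w b))))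

Atomic : FSet → Set
Atomic X = ∀ {x} → x ∈ X → ∃ λ p → x ≡ var p

data Shape (X : FSet) : Set where
  atomic      : Atomic X → Shape X
  negation    : ∀ a X₀ → X ↭ (¬' a ∷ X₀) → Shape X
  disjunction : ∀ a b X₀ → X ↭ ((a ∨' b) ∷ X₀) → Shape X

shape : ∀ X → Shape X
shape []             = atomic (λ ())
shape (¬' a ∷ X)     = negation a X ↭-refl
shape ((a ∨' b) ∷ X) = disjunction a b X ↭-refl
shape (var p ∷ X) with shape X
... | atomic at           = atomic λ { (here refl) → p , refl ; (there m) → at m }
... | negation a X₀ π     = negation a (var p ∷ X₀) (↭-trans (prep _ π) (swap _ _ ↭-refl))
... | disjunction a b X₀ π = disjunction a b (var p ∷ X₀) (↭-trans (prep _ π) (swap _ _ ↭-refl))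

atoms : FSet → List Prop
atoms []             = []
atoms (var p ∷ X)    = p ∷ atoms X
atoms (¬' a ∷ X)     = atoms X
atoms ((a ∨' b) ∷ X) = atoms X

var∈⇒∈atoms : ∀ {q} X → var q ∈ X → q ∈ atoms X
var∈⇒∈atoms (var p ∷ X)    (here refl) = here refl
var∈⇒∈atoms (var p ∷ X)    (there m)   = there (var∈⇒∈atoms X m)
var∈⇒∈atoms (¬' a ∷ X)     (there m)   = var∈⇒∈atoms X m
var∈⇒∈atoms ((a ∨' b) ∷ X) (there m)   = var∈⇒∈atoms X m

∈atoms⇒var∈ : ∀ {q} X → q ∈ atoms X → var q ∈ X
∈atoms⇒var∈ (var p ∷ X)    (here refl) = here refl
∈atoms⇒var∈ (var p ∷ X)    (there m)   = there (∈atoms⇒var∈ X m)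
∈atoms⇒var∈ (¬' a ∷ X)     m           = there (∈atoms⇒var∈ X m)
∈atoms⇒var∈ ((a ∨' b) ∷ X) m           = there (∈atoms⇒var∈ X m)

atomsTrue : FSet → Prop → Bool
atomsTrue X q = ⌊ q ∈? atoms X ⌋

atomsTrue-Sat : ∀ {X} → Atomic X → Sat (atomsTrue X) X
atomsTrue-Sat {X} at m with at m
... | p , refl = Equivalence.to T-≡ (fromWitness (var∈⇒∈atoms X m))

atomsTrue-true : ∀ {q} X → atomsTrue X q ≡ true → var q ∈ X
atomsTrue-true X t = ∈atoms⇒var∈ X (toWitness (Equivalence.from T-≡ t))

-- A valid sequent of atoms has an atom on both sides, since atomsTrue Γ must
-- make some atom of Δ true.
shared-atom : ∀ {Γ Δ} → Atomic Γ → Atomic Δ → Valid Γ Δ → ∃ λ z → z ∈ Γ × z ∈ Δ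
shared-atom {Γ} atΓ atΔ valid with valid (atomsTrue Γ) (atomsTrue-Sat atΓ)
... | y , y∈Δ , t with atΔ y∈Δ
... | q , refl = var q , atomsTrue-true Γ t , y∈Δ

weakenˡ : ∀ {K c Γ Δ} L → ⊢[ K , c ] Γ ⇒ Δ → ⊢[ K , c ] (L ++ Γ) ⇒ Δ
weakenˡ []      d = d
weakenˡ (x ∷ L) d = W⇒ x (weakenˡ L d) ≋-refl

weakenʳ : ∀ {K c Γ Δ} L → ⊢[ K , c ] Γ ⇒ Δ → ⊢[ K , c ] Γ ⇒ (L ++ Δ)
weakenʳ []      d = d
weakenʳ (x ∷ L) d = ⇒W x (weakenʳ L d) ≋-refl

-- A sequent sharing a formula z between its sides is derivable from z ⇒ z by
-- weakenings; the last two weakenings absorb the extra copies of z.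
identity : ∀ {K c z} X D → z ∈ X → z ∈ D → ⊢[ K , c ] X ⇒ D
identity []      _       ()  _
identity (_ ∷ _) []      _   ()
identity {z = z} (x ∷ X) (y ∷ D) z∈X z∈D =
  W⇒ x (weakenˡ X (⇒W y (weakenʳ D (ax z ≋-refl ≋-refl)) (≋-absorb (y ∷ D) z∈D)))
     (≋-absorb (x ∷ X) z∈X)

-- Root-first proof search in cut-free H

Search : ℕ → Set
Search n = ∀ Γ P Δ → W (Γ ++ Δ) < n → Valid Γ Δ → Γ ⊆ᵛ (P ++ Δ) →
           ⊢[ H , false ] Γ ⇒ (P ++ Δ)

lower : ∀ {m n} → m ≤ n → Search n → Search m
lower m≤n search Γ P Δ bound = search Γ P Δ (<-≤-trans bound m≤n)

-- ¬a on the left: apply (¬ᴴ⇒); its side condition is the cover of ¬a ∈ Γ.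
search-¬⇒ : ∀ {Γ P Δ} a Γ₀ → Γ ↭ (¬' a ∷ Γ₀) → Search (W (Γ ++ Δ)) →
            Valid Γ Δ → Γ ⊆ᵛ (P ++ Δ) → ⊢[ H , false ] Γ ⇒ (P ++ Δ)
search-¬⇒ {Γ} {P} {Δ} a Γ₀ π ih valid cover =
  ¬ᴴ⇒ a refl (λ p → cover p ∘ vars-∈ (Γ₀⁺⊆Γ (here refl)) p)
      (↭⇒≋ (shift a P Δ)) (↭⇒≋ π)
      (ih Γ₀ P (a ∷ Δ) lighter (Valid-¬ˡ (Valid-⊆ (∈-resp-↭ π) ⊆-refl valid)) cover′)
  where
  Γ₀⁺⊆Γ : (¬' a ∷ Γ₀) ⊆ Γ
  Γ₀⁺⊆Γ = ∈-resp-↭ (↭-sym π)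
  lighter : W (Γ₀ ++ a ∷ Δ) < W (Γ ++ Δ)
  lighter = W-decrease (a ∷ []) (shift a Γ₀ Δ) (↭-++⁺ʳ Δ π) (lighter-¬ a)
  cover′ : Γ₀ ⊆ᵛ (P ++ a ∷ Δ)
  cover′ p = ⊆⇒⊆ᵛ (⊆-++⁺ˡ P (xs⊆x∷xs Δ a)) p ∘ cover p ∘ ⊆⇒⊆ᵛ (Γ₀⁺⊆Γ ∘ there) p

search-∨⇒ : ∀ {Γ P Δ} a b Γ₀ → Γ ↭ ((a ∨' b) ∷ Γ₀) → Search (W (Γ ++ Δ)) →
            Valid Γ Δ → Γ ⊆ᵛ (P ++ Δ) → ⊢[ H , false ] Γ ⇒ (P ++ Δ)
search-∨⇒ {Γ} {P} {Δ} a b Γ₀ π ih valid cover =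
  ∨⇒ a b ≋-refl ≋-refl (↭⇒≋ π)
     (ih (a ∷ Γ₀) P Δ (W-decrease (a ∷ []) ↭-refl π⁺ (lighter-∨₁ a b))
         (Valid-∨ˡ₁ valid′) (⊆ᵛ-∷ a Γ₀ (P ++ Δ) (λ p → coverₐᵦ p ∘ ∈-++⁺ˡ) cover₀))
     (ih (b ∷ Γ₀) P Δ (W-decrease (b ∷ []) ↭-refl π⁺ (lighter-∨₂ a b))
         (Valid-∨ˡ₂ valid′) (⊆ᵛ-∷ b Γ₀ (P ++ Δ) (λ p → coverₐᵦ p ∘ ∈-++⁺ʳ (vars a)) cover₀))
  where
  Γ₀⁺⊆Γ : ((a ∨' b) ∷ Γ₀) ⊆ Γ
  Γ₀⁺⊆Γ = ∈-resp-↭ (↭-sym π)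
  π⁺ : (Γ ++ Δ) ↭ ((a ∨' b) ∷ Γ₀ ++ Δ)
  π⁺ = ↭-++⁺ʳ Δ π
  valid′ : Valid ((a ∨' b) ∷ Γ₀) Δ
  valid′ = Valid-⊆ (∈-resp-↭ π) ⊆-refl valid
  coverₐᵦ : ∀ p → p ∈ vars (a ∨' b) → p ∈ varsS (P ++ Δ)
  coverₐᵦ p = cover p ∘ vars-∈ (Γ₀⁺⊆Γ (here refl)) p
  cover₀ : Γ₀ ⊆ᵛ (P ++ Δ)
  cover₀ p = cover p ∘ ⊆⇒⊆ᵛ (Γ₀⁺⊆Γ ∘ there) p

-- ¬a on the right: apply (⇒¬) and keep ¬a in the reserve, where it covers the
-- variables of a, which has moved to the left.
search-⇒¬ : ∀ {Γ P Δ} a Δ₀ → Δ ↭ (¬' a ∷ Δ₀) → Search (W (Γ ++ Δ)) →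
            Valid Γ Δ → Γ ⊆ᵛ (P ++ Δ) → ⊢[ H , false ] Γ ⇒ (P ++ Δ)
search-⇒¬ {Γ} {P} {Δ} a Δ₀ π ih valid cover =
  ⇒¬ a ≋-refl (≋-contract (↭⇒≋ πP))
     (ih (a ∷ Γ) (¬' a ∷ P) Δ₀ (W-decrease (a ∷ []) ↭-refl (pull Γ π) (lighter-¬ a))
         (Valid-¬ʳ (Valid-⊆ ⊆-refl (∈-resp-↭ π) valid))
         (⊆ᵛ-∷ a Γ (¬' a ∷ P ++ Δ₀) (λ p → ∈-++⁺ˡ) cover′))
  where
  πP : (P ++ Δ) ↭ (¬' a ∷ P ++ Δ₀)
  πP = pull P π
  cover′ : Γ ⊆ᵛ (¬' a ∷ P ++ Δ₀)
  cover′ p = ⊆⇒⊆ᵛ (∈-resp-↭ πP) p ∘ cover p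

search-⇒∨ : ∀ {Γ P Δ} a b Δ₀ → Δ ↭ ((a ∨' b) ∷ Δ₀) → Search (W (Γ ++ Δ)) →
            Valid Γ Δ → Γ ⊆ᵛ (P ++ Δ) → ⊢[ H , false ] Γ ⇒ (P ++ Δ)
search-⇒∨ {Γ} {P} {Δ} a b Δ₀ π ih valid cover =
  ⇒∨ a b (↭⇒≋ (pull₂ P Δ₀)) (↭⇒≋ (pull P π))
     (ih Γ P (a ∷ b ∷ Δ₀) (W-decrease (a ∷ b ∷ []) (pull₂ Γ Δ₀) (pull Γ π) (lighter-∨ a b))
         (Valid-∨ʳ (Valid-⊆ ⊆-refl (∈-resp-↭ π) valid))
         cover′)
  where
  front⊆ : (a ∷ b ∷ P ++ Δ₀) ⊆ (P ++ a ∷ b ∷ Δ₀)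
  front⊆ = ∈-resp-↭ (↭-sym (pull₂ P Δ₀))
  cover-∨ : ((a ∨' b) ∷ P ++ Δ₀) ⊆ᵛ (P ++ a ∷ b ∷ Δ₀)
  cover-∨ = ⊆ᵛ-∷ (a ∨' b) (P ++ Δ₀) (P ++ a ∷ b ∷ Δ₀)
              (vars-∨-∈ (front⊆ (here refl)) (front⊆ (there (here refl))))
              (⊆⇒⊆ᵛ (front⊆ ∘ there ∘ there))
  cover′ : Γ ⊆ᵛ (P ++ a ∷ b ∷ Δ₀)
  cover′ p = cover-∨ p ∘ ⊆⇒⊆ᵛ (∈-resp-↭ (pull P π)) p ∘ cover p

search-step : ∀ {Γ P Δ} → Search (W (Γ ++ Δ)) →
              Valid Γ Δ → Γ ⊆ᵛ (P ++ Δ) → ⊢[ H , false ] Γ ⇒ (P ++ Δ)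
search-step {Γ} {P} {Δ} ih valid cover with shape Γ | shape Δ
... | negation a Γ₀ π      | _ = search-¬⇒ a Γ₀ π ih valid cover
... | disjunction a b Γ₀ π | _ = search-∨⇒ a b Γ₀ π ih valid cover
... | atomic _ | negation a Δ₀ π      = search-⇒¬ a Δ₀ π ih valid cover
... | atomic _ | disjunction a b Δ₀ π = search-⇒∨ a b Δ₀ π ih valid cover
... | atomic atΓ | atomic atΔ with shared-atom atΓ atΔ valid
... | z , z∈Γ , z∈Δ = identity Γ (P ++ Δ) z∈Γ (∈-++⁺ʳ P z∈Δ)

search : ∀ n → Search n
search zero    _ _ _ ()
search (suc n) Γ P Δ bound = search-step (lower (≤-pred bound) (search n))

mainTheorem17 : (Γ Δ : FSet) → NonEmptySeq Γ Δ →
    ⊢[ C , true ] Γ ⇒ Δ → Γ ⊆ᵛ Δ → ⊢[ H , false ] Γ ⇒ Δ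
mainTheorem17 Γ Δ _ d cover =
  search (suc (W (Γ ++ Δ))) Γ [] Δ ≤-refl (sound d) cover
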